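{- Let $p$ be a positive integer. For $n \geq 0$, let $a(n,p)$ be the total number of parts congruent to $0 \pmod{p}$, counted over all partitions of $n$ in which every part appears at most $p-1$ times, and let $o_{p}(n)$ be the number of partitions of $n$ in which the set of (distinct values of) parts congruent to $0 \pmod{p}$ has exactly one element (that part may appear with any multiplicity; parts not divisible by $p$ are unrestricted). Then for all $n \geq 0$, $$p \mid a(n,p) - o_{p}(n).$$ -}

module Defs where

open import Data.Nat using (ℕ; _≤_; _<_; _≥_)
open import Data.Nat.Divisibility using (_∣_; _∣?_)
open import Data.Nat.Properties using (_≟_)
open import Data.List using (List; length; filter)
open import Data.Nat.ListAction using (sum)
open import Data.List.Relation.Unary.All using (All)
open import Data.List.Relation.Unary.Linked using (Linked)
open import Data.List.Membership.Propositional using (_∈_)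
open import Data.Product using (_×_; ∃-syntax)
open import Relation.Binary.PropositionalEquality using (_≡_)

IsPartition : ℕ → List ℕ → Set
IsPartition n λs = All (1 ≤_) λs × Linked _≥_ λs × sum λs ≡ n

mult : ℕ → List ℕ → ℕ
mult x λs = length (filter (_≟ x) λs)

AtMostPMinus1Times : ℕ → List ℕ → Set
AtMostPMinus1Times p λs = All (λ x → mult x λs < p) λs

numPartsDiv : ℕ → List ℕ → ℕ
numPartsDiv p λs = length (filter (p ∣?_) λs)

OneDivisibleValue : ℕ → List ℕ → Set
OneDivisibleValue p λs =
  ∃[ d ] (p ∣ d × d ∈ λs × All (λ x → p ∣ x → x ≡ d) λs)

-- For a multiple j of p put x = q^j and R = ∏_{v ≠ j} (1 + q^v + … + q^((p-1)v)). The parts equal to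
-- j, counted over the partitions in which every part occurs fewer than p times, have generating
-- function (Σ_{m<p} m x^m) · R. The partitions in which j is the only multiple of p have generating
-- function x/(1 - x) · ∏_{p ∤ v} 1/(1 - q^v); by Glaisher's identity
-- ∏_v (1 + q^v + … + q^((p-1)v)) = ∏_{p ∤ v} 1/(1 - q^v) this is
-- x/(1 - x) · (1 + x + … + x^(p-1)) · R = (Σ_m min(m, p) x^m) · R
--   = (Σ_{m<p} m x^m) · R + p · (Σ_{m≥p} x^m) · R.
-- Summing over j, the two counts differ by a multiple of p. Glaisher's identity follows by multiplying
-- both sides by ∏_{p ∣ v} 1/(1 - q^v) and using (1 + y + … + y^(p-1)) / (1 - y^p) = 1/(1 - y).
module Submission where

open import Defs

open import Data.Bool using (Bool; true; false; if_then_else_)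
open import Data.List using (List; []; _∷_; _++_; map; replicate; length; filter)
open import Data.List.Membership.Propositional using (_∈_)
open import Data.List.Membership.Propositional.Properties
  using (∈-filter⁺; ∈-filter⁻; ∈-map⁺; ∈-map⁻; ∈-++⁺ˡ; ∈-++⁺ʳ; ∈-++⁻)
open import Data.List.Membership.Propositional.Properties.WithK using (unique∧set⇒bag)
open import Data.List.Properties
  using (≡-dec; filter-accept; filter-reject; map-++; map-∘; map-cong-local; ++-cancelˡ)
open import Data.List.Relation.Binary.BagAndSetEquality using (∼bag⇒↭)
import Data.List.Relation.Binary.Permutation.Propositional.Properties as ↭
open import Data.List.Relation.Unary.All using (All; []; _∷_; tabulate; lookup) renaming (map to All-map)
import Data.List.Relation.Unary.All.Properties as All
open import Data.List.Relation.Unary.Any using (here; there)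
open import Data.List.Relation.Unary.Linked as Linked using (Linked; []; [-]; _∷_)
open import Data.List.Relation.Unary.Unique.Propositional using (Unique; []; _∷_)
import Data.List.Relation.Unary.Unique.Propositional.Properties as Unique
open import Data.Nat
  using (ℕ; NonZero; zero; suc; _+_; _*_; _∸_; _≤_; _<_; _≥_; z≤n; s≤s; _≤?_; _≟_)
open import Data.Nat.Divisibility
  using (_∣?_; ∣⇒≤; m∣m*n; ∣m+n∣m⇒∣n) renaming (_∣_ to _∣ₙ_)
open import Data.Nat.ListAction using (sum)
open import Data.Nat.ListAction.Properties using (sum-++; sum-↭)
open import Data.Nat.Properties
open import Data.Nat.Tactic.RingSolver using (solve-∀)
open import Data.List.Membership.DecPropositional (≡-dec _≟_) using (_∈?_)
open import Data.Product using (_×_; _,_; ∃-syntax; proj₁; proj₂)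
open import Data.Sum using (_⊎_; inj₁; inj₂)
open import Function using (_∘_)
open import Function.Bundles using (_⇔_; mk⇔; Equivalence)
open import Relation.Binary.PropositionalEquality
open import Relation.Nullary using (Dec; yes; no; does; ¬_)
open import Relation.Nullary.Decidable using (dec-true; dec-false; decidable-stable)
open import Relation.Nullary.Negation using (contradiction)
open import Relation.Unary using (Decidable)

Σ< : ℕ → (ℕ → ℕ) → ℕ
Σ< zero    F = 0
Σ< (suc M) F = F 0 + Σ< M (F ∘ suc)

Σ<-cong : ∀ M {F G : ℕ → ℕ} → (∀ m → m < M → F m ≡ G m) → Σ< M F ≡ Σ< M G
Σ<-cong zero    F≡G = refl
Σ<-cong (suc M) F≡G =
  cong₂ _+_ (F≡G 0 (s≤s z≤n)) (Σ<-cong M (λ m m<M → F≡G (suc m) (s≤s m<M)))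

Σ<-cong′ : ∀ M {F G : ℕ → ℕ} → F ≗ G → Σ< M F ≡ Σ< M G
Σ<-cong′ M F≗G = Σ<-cong M (λ m _ → F≗G m)

Σ<-zero : ∀ M (F : ℕ → ℕ) → (∀ m → m < M → F m ≡ 0) → Σ< M F ≡ 0
Σ<-zero zero    F F≡0 = refl
Σ<-zero (suc M) F F≡0 =
  cong₂ _+_ (F≡0 0 (s≤s z≤n)) (Σ<-zero M (F ∘ suc) (λ m m<M → F≡0 (suc m) (s≤s m<M)))

Σ<-+ : ∀ M (F G : ℕ → ℕ) → Σ< M (λ m → F m + G m) ≡ Σ< M F + Σ< M G
Σ<-+ zero    F G = refl
Σ<-+ (suc M) F G =
  trans (cong (F 0 + G 0 +_) (Σ<-+ M (F ∘ suc) (G ∘ suc))) (interchange (F 0) (G 0) _ _)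
  where
  interchange : ∀ a b c d → (a + b) + (c + d) ≡ (a + c) + (b + d)
  interchange = solve-∀

Σ<-* : ∀ M k (F : ℕ → ℕ) → Σ< M (λ m → k * F m) ≡ k * Σ< M F
Σ<-* zero    k F = sym (*-zeroʳ k)
Σ<-* (suc M) k F = trans (cong (k * F 0 +_) (Σ<-* M k (F ∘ suc))) (sym (*-distribˡ-+ k (F 0) _))

Σ<-extend : ∀ {M M′} (F : ℕ → ℕ) → M ≤ M′ → (∀ m → M ≤ m → F m ≡ 0) →
  Σ< M′ F ≡ Σ< M F
Σ<-extend {M′ = M′} F z≤n        F≡0 = Σ<-zero M′ F (λ m _ → F≡0 m z≤n)
Σ<-extend           F (s≤s M≤M′) F≡0 =
  cong (F 0 +_) (Σ<-extend (F ∘ suc) M≤M′ (λ m M≤m → F≡0 (suc m) (s≤s M≤m)))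

Σ<-swap : ∀ M M′ (H : ℕ → ℕ → ℕ) →
  Σ< M (λ m → Σ< M′ (H m)) ≡ Σ< M′ (λ m′ → Σ< M (λ m → H m m′))
Σ<-swap zero    M′ H = sym (Σ<-zero M′ _ (λ _ _ → refl))
Σ<-swap (suc M) M′ H = trans (cong (Σ< M′ (H 0) +_) (Σ<-swap M M′ (H ∘ suc)))
                             (sym (Σ<-+ M′ (H 0) (λ m′ → Σ< M (λ m → H (suc m) m′))))

Σ<-snoc : ∀ M (F : ℕ → ℕ) → Σ< (suc M) F ≡ Σ< M F + F M
Σ<-snoc zero    F = +-comm (F 0) 0
Σ<-snoc (suc M) F = trans (cong (F 0 +_) (Σ<-snoc M (F ∘ suc))) (sym (+-assoc (F 0) _ _))

Σ<-single : ∀ M k (F : ℕ → ℕ) → k < M → (∀ m → m < M → m ≢ k → F m ≡ 0) →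
  Σ< M F ≡ F k
Σ<-single (suc M) zero    F _         F≡0 =
  trans (cong (F 0 +_) (Σ<-zero M _ (λ m m<M → F≡0 (suc m) (s≤s m<M) (λ ())))) (+-identityʳ _)
Σ<-single (suc M) (suc k) F (s≤s k<M) F≡0 = cong₂ _+_ (F≡0 0 (s≤s z≤n) (λ ()))
  (Σ<-single M k (F ∘ suc) k<M (λ m m<M m≢k → F≡0 (suc m) (s≤s m<M) (m≢k ∘ suc-injective)))

-- Matching on the Dec itself (rather than on does P?) lets `with P?` abstract it in goals.
when : {P : Set} → Dec P → ℕ → ℕ
when (yes _) x = x
when (no _)  _ = 0

when-yes : ∀ {P : Set} (P? : Dec P) {x} → P → when P? x ≡ x
when-yes (yes _) p = refl
when-yes (no ¬p) p = contradiction p ¬p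

when-no : ∀ {P : Set} (P? : Dec P) {x} → ¬ P → when P? x ≡ 0
when-no (yes p) ¬p = contradiction p ¬p
when-no (no _)  ¬p = refl

when-cong : ∀ {P Q : Set} (P? : Dec P) (Q? : Dec Q) {x y} → (P → Q) → (Q → P) → x ≡ y →
  when P? x ≡ when Q? y
when-cong (yes p) Q? P→Q Q→P refl = sym (when-yes Q? (P→Q p))
when-cong (no ¬p) Q? P→Q Q→P refl = sym (when-no Q? (¬p ∘ Q→P))

when-+ : ∀ {P : Set} (P? : Dec P) x y → when P? (x + y) ≡ when P? x + when P? y
when-+ (yes _) x y = refl
when-+ (no _)  x y = refl

when-* : ∀ {P : Set} (P? : Dec P) k x → when P? (k * x) ≡ k * when P? x
when-* (yes _) k x = refl
when-* (no _)  k x = sym (*-zeroʳ k)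

when-0 : ∀ {P : Set} (P? : Dec P) → when P? 0 ≡ 0
when-0 (yes _) = refl
when-0 (no _)  = refl

-- Power series

Series : Set
Series = ℕ → ℕ

_≈[_]_ : Series → ℕ → Series → Set
f ≈[ N ] g = ∀ t → t ≤ N → f t ≡ g t

-- Series are formal power series in q: shift s g is q^s · g and mul v c f is (Σₘ c m · q^(m·v)) · f.
-- The sum in mul stops at m = N, which is only right for v ≥ 1; hence the lemmas take v = suc w.
shift : ℕ → Series → Series
shift s g N = when (s ≤? N) (g (N ∸ s))

mul-term : ℕ → (ℕ → ℕ) → Series → ℕ → ℕ → ℕ
mul-term v c f N m = when (m * v ≤? N) (c m * f (N ∸ m * v))

mul : ℕ → (ℕ → ℕ) → Series → Series
mul v c f N = Σ< (suc N) (mul-term v c f N)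

≤∸⇒+≤ : ∀ {a b N} → a ≤ N → b ≤ N ∸ a → a + b ≤ N
≤∸⇒+≤ {a} a≤N b≤N∸a = ≤-trans (+-monoʳ-≤ a b≤N∸a) (≤-reflexive (m+[n∸m]≡n a≤N))

+≤⇒≤∸ : ∀ {a b N} → a + b ≤ N → b ≤ N ∸ a
+≤⇒≤∸ {a} {b} {N} a+b≤N = m+n≤o⇒m≤o∸n b (subst (_≤ N) (+-comm a b) a+b≤N)

mul-cong≈ : ∀ v c {f g} N → f ≈[ N ] g → mul v c f ≈[ N ] mul v c g
mul-cong≈ v c N f≈g t t≤N = Σ<-cong′ (suc t) λ m →
  cong (when (m * v ≤? t)) (cong (c m *_) (f≈g _ (≤-trans (m∸n≤m t (m * v)) t≤N)))

mul-cong : ∀ v c {f g} → f ≗ g → mul v c f ≗ mul v c g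
mul-cong v c f≗g N = mul-cong≈ v c N (λ t _ → f≗g t) N ≤-refl

mul-congˡ : ∀ v {c d} f → c ≗ d → mul v c f ≗ mul v d f
mul-congˡ v f c≗d N = Σ<-cong′ (suc N) λ m →
  cong (when (m * v ≤? N)) (cong (_* f (N ∸ m * v)) (c≗d m))

mul-zeroˡ : ∀ v f N → mul v (λ _ → 0) f N ≡ 0
mul-zeroˡ v f N = Σ<-zero (suc N) _ λ m _ → when-0 (m * v ≤? N)

mul-zeroʳ : ∀ v c N → mul v c (λ _ → 0) N ≡ 0
mul-zeroʳ v c N = Σ<-zero (suc N) _ λ m _ →
  trans (cong (when (m * v ≤? N)) (*-zeroʳ (c m))) (when-0 _)

mul-+ʳ : ∀ v c f g N → mul v c (λ t → f t + g t) N ≡ mul v c f N + mul v c g N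
mul-+ʳ v c f g N = trans (Σ<-cong′ (suc N) split) (Σ<-+ (suc N) (mul-term v c f N) (mul-term v c g N))
  where
  split : ∀ m → mul-term v c (λ t → f t + g t) N m ≡ mul-term v c f N m + mul-term v c g N m
  split m = trans (cong (when (m * v ≤? N)) (*-distribˡ-+ (c m) _ _)) (when-+ (m * v ≤? N) _ _)

mul-+ˡ : ∀ v c d f N → mul v (λ m → c m + d m) f N ≡ mul v c f N + mul v d f N
mul-+ˡ v c d f N = trans (Σ<-cong′ (suc N) split) (Σ<-+ (suc N) (mul-term v c f N) (mul-term v d f N))
  where
  split : ∀ m → mul-term v (λ m → c m + d m) f N m ≡ mul-term v c f N m + mul-term v d f N m
  split m = trans (cong (when (m * v ≤? N)) (*-distribʳ-+ _ (c m) (d m))) (when-+ (m * v ≤? N) _ _)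

mul-*ˡ : ∀ v k c f N → mul v (λ m → k * c m) f N ≡ k * mul v c f N
mul-*ˡ v k c f N = trans (Σ<-cong′ (suc N) pull) (Σ<-* (suc N) k (mul-term v c f N))
  where
  pull : ∀ m → mul-term v (λ m → k * c m) f N m ≡ k * mul-term v c f N m
  pull m = trans (cong (when (m * v ≤? N)) (*-assoc k (c m) _)) (when-* (m * v ≤? N) k _)

mul-Σʳ : ∀ v c M (F : ℕ → Series) N →
  mul v c (λ t → Σ< M (λ d → F d t)) N ≡ Σ< M (λ d → mul v c (F d) N)
mul-Σʳ v c zero    F N = mul-zeroʳ v c N
mul-Σʳ v c (suc M) F N = trans (mul-+ʳ v c (F 0) (λ t → Σ< M (λ d → F (suc d) t)) N)
                               (cong (mul v c (F 0) N +_) (mul-Σʳ v c M (F ∘ suc) N))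

mul-Σˡ : ∀ v M (C : ℕ → ℕ → ℕ) f N →
  mul v (λ m → Σ< M (λ d → C d m)) f N ≡ Σ< M (λ d → mul v (C d) f N)
mul-Σˡ v zero    C f N = mul-zeroˡ v f N
mul-Σˡ v (suc M) C f N = trans (mul-+ˡ v (C 0) (λ m → Σ< M (λ d → C (suc d) m)) f N)
                               (cong (mul v (C 0) f N +_) (mul-Σˡ v M (C ∘ suc) f N))

shift-cong : ∀ s {g h} → g ≗ h → shift s g ≗ shift s h
shift-cong s g≗h N = cong (when (s ≤? N)) (g≗h (N ∸ s))

shift-cong< : ∀ w {g h} M → (∀ t → t < M → g t ≡ h t) → shift (suc w) g M ≡ shift (suc w) h M
shift-cong< w M g≡h with suc w ≤? M
... | yes v≤M = g≡h (M ∸ suc w) (∸-monoʳ-< {o = 0} (s≤s z≤n) v≤M)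
... | no _    = refl

shift-by-0 : ∀ g → shift 0 g ≗ g
shift-by-0 g N = when-yes (0 ≤? N) z≤n

shift-Σ : ∀ s M (G : ℕ → Series) N →
  shift s (λ t → Σ< M (λ d → G d t)) N ≡ Σ< M (λ d → shift s (G d) N)
shift-Σ s zero    G N = when-0 (s ≤? N)
shift-Σ s (suc M) G N =
  trans (when-+ (s ≤? N) (G 0 (N ∸ s)) _) (cong (shift s (G 0) N +_) (shift-Σ s M (G ∘ suc) N))

shift-shift : ∀ a b g → shift a (shift b g) ≗ shift (a + b) g
shift-shift a b g N with a ≤? N
... | yes a≤N =
  when-cong (b ≤? N ∸ a) (a + b ≤? N) (≤∸⇒+≤ a≤N) +≤⇒≤∸ (cong g (∸-+-assoc N a b))
... | no  a≰N = sym (when-no (a + b ≤? N) (a≰N ∘ m+n≤o⇒m≤o a))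

mul-unfold : ∀ w c f N → mul (suc w) c f N ≡ c 0 * f N + shift (suc w) (mul (suc w) (c ∘ suc) f) N
mul-unfold w c f N = cong₂ _+_ (when-yes (0 ≤? N) z≤n) tail
  where
  v = suc w
  tail : Σ< N (mul-term v c f N ∘ suc) ≡ shift v (mul v (c ∘ suc) f) N
  tail with v ≤? N
  ... | no v≰N = Σ<-zero N _ λ m _ → when-no (suc m * v ≤? N) (v≰N ∘ m+n≤o⇒m≤o v)
  ... | yes v≤N =
    trans (Σ<-extend (mul-term v c f N ∘ suc) N∸v<N vanish) (Σ<-cong′ (suc (N ∸ v)) shifted)
    where
    shifted : ∀ m → mul-term v c f N (suc m) ≡ mul-term v (c ∘ suc) f (N ∸ v) m
    shifted m = when-cong (suc m * v ≤? N) (m * v ≤? N ∸ v) +≤⇒≤∸ (≤∸⇒+≤ v≤N)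
                          (cong (λ k → c (suc m) * f k) (sym (∸-+-assoc N v (m * v))))
    N∸v<N : suc (N ∸ v) ≤ N
    N∸v<N = ∸-monoʳ-< {o = 0} (s≤s z≤n) v≤N
    vanish : ∀ m → suc (N ∸ v) ≤ m → mul-term v c f N (suc m) ≡ 0
    vanish m N∸v<m = when-no (suc m * v ≤? N) λ v+mv≤N →
      <⇒≱ N∸v<m (≤-trans (m≤m*n m v) (+≤⇒≤∸ v+mv≤N))

mul-low : ∀ w c f N → N < suc w → mul (suc w) c f N ≡ c 0 * f N
mul-low w c f N N<v = trans (mul-unfold w c f N)
  (trans (cong (c 0 * f N +_) (when-no (suc w ≤? N) (<⇒≱ N<v))) (+-identityʳ _))

mul-mul-term : ℕ → ℕ → (ℕ → ℕ) → (ℕ → ℕ) → Series → ℕ → ℕ → ℕ → ℕ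
mul-mul-term v u c d f N m m′ = when (m * v + m′ * u ≤? N) (c m * d m′ * f (N ∸ (m * v + m′ * u)))

mul-mul : ∀ w u c d f N →
  mul (suc w) c (mul (suc u) d f) N
    ≡ Σ< (suc N) (λ m → Σ< (suc N) (mul-mul-term (suc w) (suc u) c d f N m))
mul-mul w u c d f N = Σ<-cong′ (suc N) inner
  where
  v = suc w
  u′ = suc u
  inner : ∀ m → mul-term v c (mul u′ d f) N m ≡ Σ< (suc N) (mul-mul-term v u′ c d f N m)
  inner m with m * v ≤? N
  ... | no mv≰N = sym (Σ<-zero (suc N) (mul-mul-term v u′ c d f N m) λ m′ _ →
    when-no (m * v + m′ * u′ ≤? N) (mv≰N ∘ m+n≤o⇒m≤o (m * v)))
  ... | yes mv≤N = begin
    c m * Σ< (suc (N ∸ m * v)) (mul-term u′ d f (N ∸ m * v))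
      ≡⟨ Σ<-* (suc (N ∸ m * v)) (c m) (mul-term u′ d f (N ∸ m * v)) ⟨
    Σ< (suc (N ∸ m * v)) (λ m′ → c m * mul-term u′ d f (N ∸ m * v) m′)
      ≡⟨ Σ<-cong′ (suc (N ∸ m * v)) merge ⟩
    Σ< (suc (N ∸ m * v)) (mul-mul-term v u′ c d f N m)
      ≡⟨ Σ<-extend (mul-mul-term v u′ c d f N m) (s≤s (m∸n≤m N (m * v))) vanish ⟨
    Σ< (suc N) (mul-mul-term v u′ c d f N m) ∎
    where
    open ≡-Reasoning
    merge : ∀ m′ → c m * mul-term u′ d f (N ∸ m * v) m′ ≡ mul-mul-term v u′ c d f N m m′
    merge m′ = trans (sym (when-* (m′ * u′ ≤? N ∸ m * v) (c m) _))
      (when-cong (m′ * u′ ≤? N ∸ m * v) (m * v + m′ * u′ ≤? N) (≤∸⇒+≤ mv≤N) +≤⇒≤∸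
        (trans (sym (*-assoc (c m) (d m′) _))
               (cong (λ k → c m * d m′ * f k) (∸-+-assoc N (m * v) (m′ * u′)))))
    vanish : ∀ m′ → suc (N ∸ m * v) ≤ m′ → mul-mul-term v u′ c d f N m m′ ≡ 0
    vanish m′ N∸mv<m′ = when-no (m * v + m′ * u′ ≤? N) λ mv+m′u′≤N →
      <⇒≱ N∸mv<m′ (≤-trans (m≤m*n m′ u′) (+≤⇒≤∸ {m * v} mv+m′u′≤N))

mul-comm : ∀ w u c d f → mul (suc w) c (mul (suc u) d f) ≗ mul (suc u) d (mul (suc w) c f)
mul-comm w u c d f N = begin
  mul (suc w) c (mul (suc u) d f) N
    ≡⟨ mul-mul w u c d f N ⟩
  Σ< (suc N) (λ m → Σ< (suc N) (λ m′ → mul-mul-term (suc w) (suc u) c d f N m m′))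
    ≡⟨ Σ<-cong′ (suc N) (λ m → Σ<-cong′ (suc N) (symmetric m)) ⟩
  Σ< (suc N) (λ m → Σ< (suc N) (λ m′ → mul-mul-term (suc u) (suc w) d c f N m′ m))
    ≡⟨ Σ<-swap (suc N) (suc N) (λ m m′ → mul-mul-term (suc u) (suc w) d c f N m′ m) ⟩
  Σ< (suc N) (λ m′ → Σ< (suc N) (λ m → mul-mul-term (suc u) (suc w) d c f N m′ m))
    ≡⟨ mul-mul u w d c f N ⟨
  mul (suc u) d (mul (suc w) c f) N ∎
  where
  open ≡-Reasoning
  symmetric : ∀ m m′ →
    mul-mul-term (suc w) (suc u) c d f N m m′ ≡ mul-mul-term (suc u) (suc w) d c f N m′ m
  symmetric m m′ = when-cong (m * suc w + m′ * suc u ≤? N) (m′ * suc u + m * suc w ≤? N)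
    (subst (_≤ N) swap) (subst (_≤ N) (sym swap))
    (cong₂ _*_ (*-comm (c m) (d m′)) (cong (λ k → f (N ∸ k)) swap))
    where
    swap = +-comm (m * suc w) (m′ * suc u)

-- As coefficient sequences of power series in y: ones = 1/(1 - y), δ₀ = 1, δ₁ = y,
-- below p = 1 + y + … + y^(p-1) and atLeast k = y^k/(1 - y).
ones : ℕ → ℕ
ones _ = 1

δ₀ : ℕ → ℕ
δ₀ zero    = 1
δ₀ (suc _) = 0

δ₁ : ℕ → ℕ
δ₁ zero    = 0
δ₁ (suc m) = δ₀ m

below : ℕ → ℕ → ℕ
below zero    _       = 0
below (suc p) zero    = 1
below (suc p) (suc m) = below p m

atLeast : ℕ → ℕ → ℕ
atLeast zero    _       = 1
atLeast (suc k) zero    = 0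
atLeast (suc k) (suc m) = atLeast k m

multBelow : ℕ → ℕ → ℕ
multBelow p m = m * below p m

δ₀-≢0 : ∀ m → δ₀ m ≢ 0 → m ≡ 0
δ₀-≢0 zero    _   = refl
δ₀-≢0 (suc m) δ≢0 = contradiction refl δ≢0

below-≡1 : ∀ p m → m < p → below p m ≡ 1
below-≡1 (suc p) zero    _         = refl
below-≡1 (suc p) (suc m) (s≤s m<p) = below-≡1 p m m<p

below-≢0 : ∀ p m → below p m ≢ 0 → m < p
below-≢0 zero    m       b≢0 = contradiction refl b≢0
below-≢0 (suc p) zero    _   = s≤s z≤n
below-≢0 (suc p) (suc m) b≢0 = s≤s (below-≢0 p m b≢0)

atLeast-≡1 : ∀ k m → k ≤ m → atLeast k m ≡ 1
atLeast-≡1 zero    m       _         = refl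
atLeast-≡1 (suc k) (suc m) (s≤s k≤m) = atLeast-≡1 k m k≤m

below+atLeast : ∀ p m → below p m + atLeast p m ≡ 1
below+atLeast zero    m       = refl
below+atLeast (suc p) zero    = refl
below+atLeast (suc p) (suc m) = below+atLeast p m

-- Both sides equal min m p.
Σ<-atLeast : ∀ p m → Σ< p (λ d → atLeast (suc d) m) ≡ multBelow p m + p * atLeast p m
Σ<-atLeast zero    m       = sym (trans (+-identityʳ _) (*-zeroʳ m))
Σ<-atLeast (suc p) zero    = trans (Σ<-zero (suc p) _ (λ _ _ → refl)) (sym (*-zeroʳ (suc p)))
Σ<-atLeast (suc p) (suc m) = begin
  1 + Σ< p (λ d → atLeast (suc d) m)  ≡⟨ cong (1 +_) (Σ<-atLeast p m) ⟩
  1 + (m * b + p * a)                 ≡⟨ cong (_+ (m * b + p * a)) (below+atLeast p m) ⟨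
  (b + a) + (m * b + p * a)           ≡⟨ rearrange b a m p ⟩
  suc m * b + suc p * a               ∎
  where
  open ≡-Reasoning
  b = below p m
  a = atLeast p m
  rearrange : ∀ b a m p → (b + a) + (m * b + p * a) ≡ (b + m * b) + (a + p * a)
  rearrange = solve-∀

mul-δ₀ : ∀ w g → mul (suc w) δ₀ g ≗ g
mul-δ₀ w g N = begin
  mul (suc w) δ₀ g N
    ≡⟨ mul-unfold w δ₀ g N ⟩
  1 * g N + shift (suc w) (mul (suc w) (λ _ → 0) g) N
    ≡⟨ cong (1 * g N +_) (shift-cong (suc w) (mul-zeroˡ (suc w) g) N) ⟩
  1 * g N + shift (suc w) (λ _ → 0) N
    ≡⟨ cong₂ _+_ (*-identityˡ (g N)) (when-0 (suc w ≤? N)) ⟩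
  g N + 0
    ≡⟨ +-identityʳ (g N) ⟩
  g N ∎
  where open ≡-Reasoning

mul-δ₁ : ∀ w g → mul (suc w) δ₁ g ≗ shift (suc w) g
mul-δ₁ w g N = trans (mul-unfold w δ₁ g N) (shift-cong (suc w) (mul-δ₀ w g) N)

mul-shift : ∀ w c g s → mul (suc w) c (shift s g) ≗ shift s (mul (suc w) c g)
mul-shift w c g zero    N = trans (mul-cong (suc w) c (shift-by-0 g) N) (sym (shift-by-0 (mul (suc w) c g) N))
mul-shift w c g (suc s) N = begin
  mul (suc w) c (shift (suc s) g) N   ≡⟨ mul-cong (suc w) c (λ t → sym (mul-δ₁ s g t)) N ⟩
  mul (suc w) c (mul (suc s) δ₁ g) N  ≡⟨ mul-comm w s c δ₁ g N ⟩
  mul (suc s) δ₁ (mul (suc w) c g) N  ≡⟨ mul-δ₁ s (mul (suc w) c g) N ⟩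
  shift (suc s) (mul (suc w) c g) N   ∎
  where open ≡-Reasoning

mul-below : ∀ w p h N → mul (suc w) (below p) h N ≡ Σ< p (λ d → shift (d * suc w) h N)
mul-below w zero    h N = mul-zeroˡ (suc w) h N
mul-below w (suc p) h N = begin
  mul v (below (suc p)) h N
    ≡⟨ mul-unfold w (below (suc p)) h N ⟩
  1 * h N + shift v (mul v (below p) h) N
    ≡⟨ cong₂ _+_ (trans (*-identityˡ (h N)) (sym (shift-by-0 h N)))
                 (shift-cong v (mul-below w p h) N) ⟩
  shift 0 h N + shift v (λ t → Σ< p (λ d → shift (d * v) h t)) N
    ≡⟨ cong (shift 0 h N +_) (shift-Σ v p (λ d → shift (d * v) h) N) ⟩
  shift 0 h N + Σ< p (λ d → shift v (shift (d * v) h) N)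
    ≡⟨ cong (shift 0 h N +_) (Σ<-cong′ p λ d → shift-shift v (d * v) h N) ⟩
  Σ< (suc p) (λ d → shift (d * v) h N) ∎
  where
  open ≡-Reasoning
  v = suc w

mul-atLeast : ∀ w k h → mul (suc w) (atLeast k) h ≗ shift (k * suc w) (mul (suc w) ones h)
mul-atLeast w zero    h N = sym (shift-by-0 (mul (suc w) ones h) N)
mul-atLeast w (suc k) h N = trans (mul-unfold w (atLeast (suc k)) h N)
  (trans (shift-cong (suc w) (mul-atLeast w k h) N) (shift-shift (suc w) (k * suc w) (mul (suc w) ones h) N))

mul-ones-unfold : ∀ w f N → mul (suc w) ones f N ≡ f N + shift (suc w) (mul (suc w) ones f) N
mul-ones-unfold w f N =
  trans (mul-unfold w ones f N) (cong (_+ shift (suc w) (mul (suc w) ones f) N) (*-identityˡ (f N)))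

≈-by-induction : ∀ {x y : Series} N →
  (∀ M → M ≤ N → (∀ t → t < M → x t ≡ y t) → x M ≡ y M) → x ≈[ N ] y
≈-by-induction zero step .0 z≤n = step 0 z≤n (λ _ ())
≈-by-induction {x} {y} (suc N) step t t≤1+N = extend (m≤n⇒m<n∨m≡n t≤1+N)
  where
  earlier : x ≈[ N ] y
  earlier = ≈-by-induction N (λ M M≤N → step M (m≤n⇒m≤1+n M≤N))
  extend : t < suc N ⊎ t ≡ suc N → x t ≡ y t
  extend (inj₁ t<1+N) = earlier t (≤-pred t<1+N)
  extend (inj₂ t≡1+N) = subst (λ s → x s ≡ y s) (sym t≡1+N)
    (step (suc N) ≤-refl (λ s s<1+N → earlier s (≤-pred s<1+N)))

shift-recurrence-unique : ∀ w (f g h : Series) →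
  (∀ N → g N ≡ f N + shift (suc w) g N) → (∀ N → h N ≡ f N + shift (suc w) h N) → g ≗ h
shift-recurrence-unique w f g h g-rec h-rec N = ≈-by-induction N step N ≤-refl
  where
  step : ∀ M → M ≤ N → (∀ t → t < M → g t ≡ h t) → g M ≡ h M
  step M _ g≡h = trans (g-rec M) (trans (cong (f M +_) (shift-cong< w M g≡h)) (sym (h-rec M)))

mul-cancel : ∀ w c {x y} N → c 0 ≡ 1 → mul (suc w) c x ≈[ N ] mul (suc w) c y → x ≈[ N ] y
mul-cancel w c {x} {y} N c0≡1 eq = ≈-by-induction N step
  where
  v = suc w
  step : ∀ M → M ≤ N → (∀ t → t < M → x t ≡ y t) → x M ≡ y M
  step M M≤N x≡y = begin
    x M        ≡⟨ *-identityˡ (x M) ⟨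
    1 * x M    ≡⟨ cong (_* x M) c0≡1 ⟨
    c 0 * x M  ≡⟨ +-cancelʳ-≡ _ _ _ (begin
      c 0 * x M + shift v (mul v (c ∘ suc) y) M  ≡⟨ cong (c 0 * x M +_) tails ⟨
      c 0 * x M + shift v (mul v (c ∘ suc) x) M  ≡⟨ mul-unfold w c x M ⟨
      mul v c x M                                ≡⟨ eq M M≤N ⟩
      mul v c y M                                ≡⟨ mul-unfold w c y M ⟩
      c 0 * y M + shift v (mul v (c ∘ suc) y) M  ∎) ⟩
    c 0 * y M  ≡⟨ cong (_* y M) c0≡1 ⟩
    1 * y M    ≡⟨ *-identityˡ (y M) ⟩
    y M        ∎
    where
    open ≡-Reasoning
    tails : shift v (mul v (c ∘ suc) x) M ≡ shift v (mul v (c ∘ suc) y) M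
    tails = shift-cong< w M λ t t<M →
      mul-cong≈ v (c ∘ suc) t (λ s s≤t → x≡y s (≤-<-trans s≤t t<M)) t ≤-refl

-- (1 + q^v + … + q^((p-1)v)) / (1 - q^(pv)) = 1 / (1 - q^v): multiplied by f, both sides solve
-- g = f + q^v · g.
glaisher-factor : ∀ w p′ f →
  mul (suc w) (below (suc p′)) (mul (suc p′ * suc w) ones f) ≗ mul (suc w) ones f
glaisher-factor w p′ f = shift-recurrence-unique w f g (mul v ones f) g-rec (mul-ones-unfold w f)
  where
  v = suc w
  p = suc p′
  h = mul (p * v) ones f
  g = mul v (below p) h
  F : ℕ → ℕ → ℕ
  F N d = shift (suc d * v) h N
  g-rec : ∀ N → g N ≡ f N + shift v g N
  g-rec N = sym (begin
    f N + shift v g N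
      ≡⟨ cong (f N +_) (shift-cong v (mul-below w p h) N) ⟩
    f N + shift v (λ t → Σ< p (λ d → shift (d * v) h t)) N
      ≡⟨ cong (f N +_) (shift-Σ v p (λ d → shift (d * v) h) N) ⟩
    f N + Σ< p (λ d → shift v (shift (d * v) h) N)
      ≡⟨ cong (f N +_) (Σ<-cong′ p (λ d → shift-shift v (d * v) h N)) ⟩
    f N + Σ< p (F N)
      ≡⟨ cong (f N +_) (Σ<-snoc p′ (F N)) ⟩
    f N + (Σ< p′ (F N) + shift (p * v) h N)
      ≡⟨ rearrange (f N) _ _ ⟩
    (f N + shift (p * v) h N) + Σ< p′ (F N)
      ≡⟨ cong (_+ Σ< p′ (F N)) (mul-ones-unfold (w + p′ * v) f N) ⟨
    h N + Σ< p′ (F N)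
      ≡⟨ cong (_+ Σ< p′ (F N)) (shift-by-0 h N) ⟨
    Σ< p (λ d → shift (d * v) h N)
      ≡⟨ mul-below w p h N ⟨
    g N ∎)
    where
    open ≡-Reasoning
    rearrange : ∀ a b c → a + (b + c) ≡ (a + c) + b
    rearrange = solve-∀

mul-atLeast1-below : ∀ w p R N →
  mul (suc w) (atLeast 1) (mul (suc w) (below p) R) N
    ≡ mul (suc w) (multBelow p) R N + p * mul (suc w) (atLeast p) R N
mul-atLeast1-below w p R N = begin
  mul v (atLeast 1) (mul v (below p) R) N
    ≡⟨ mul-cong v (atLeast 1) (mul-below w p R) N ⟩
  mul v (atLeast 1) (λ t → Σ< p (λ d → shift (d * v) R t)) N
    ≡⟨ mul-Σʳ v (atLeast 1) p (λ d → shift (d * v) R) N ⟩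
  Σ< p (λ d → mul v (atLeast 1) (shift (d * v) R) N)
    ≡⟨ Σ<-cong′ p atLeast1-shift ⟩
  Σ< p (λ d → mul v (atLeast (suc d)) R N)
    ≡⟨ mul-Σˡ v p (λ d → atLeast (suc d)) R N ⟨
  mul v (λ m → Σ< p (λ d → atLeast (suc d) m)) R N
    ≡⟨ mul-congˡ v R (Σ<-atLeast p) N ⟩
  mul v (λ m → multBelow p m + p * atLeast p m) R N
    ≡⟨ mul-+ˡ v (multBelow p) (λ m → p * atLeast p m) R N ⟩
  mul v (multBelow p) R N + mul v (λ m → p * atLeast p m) R N
    ≡⟨ cong (mul v (multBelow p) R N +_) (mul-*ˡ v p (atLeast p) R N) ⟩
  mul v (multBelow p) R N + p * mul v (atLeast p) R N ∎
  where
  open ≡-Reasoning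
  v = suc w
  atLeast1-shift : ∀ d → mul v (atLeast 1) (shift (d * v) R) N ≡ mul v (atLeast (suc d)) R N
  atLeast1-shift d = begin
    mul v (atLeast 1) (shift (d * v) R) N
      ≡⟨ mul-shift w (atLeast 1) R (d * v) N ⟩
    shift (d * v) (mul v (atLeast 1) R) N
      ≡⟨ shift-cong (d * v) (mul-atLeast w 1 R) N ⟩
    shift (d * v) (shift (1 * v) (mul v ones R)) N
      ≡⟨ shift-shift (d * v) (1 * v) (mul v ones R) N ⟩
    shift (d * v + 1 * v) (mul v ones R) N
      ≡⟨ cong (λ s → shift s (mul v ones R) N) d*v+1*v≡[1+d]*v ⟩
    shift (suc d * v) (mul v ones R) N
      ≡⟨ mul-atLeast w (suc d) R N ⟨
    mul v (atLeast (suc d)) R N ∎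
    where
    d*v+1*v≡[1+d]*v : d * v + 1 * v ≡ suc d * v
    d*v+1*v≡[1+d]*v = trans (sym (*-distribʳ-+ v d 1)) (cong (_* v) (+-comm d 1))

-- Products over parts and Glaisher's identity

Weights : Set
Weights = ℕ → ℕ → ℕ

mulAll : Weights → ℕ → Series → Series
mulAll c zero    f = f
mulAll c (suc K) f = mul (suc K) (c (suc K)) (mulAll c K f)

unrestricted : Weights
unrestricted _ = ones

mulAll-cong≈ : ∀ c K N {f g} → f ≈[ N ] g → mulAll c K f ≈[ N ] mulAll c K g
mulAll-cong≈ c zero    N f≈g = f≈g
mulAll-cong≈ c (suc K) N f≈g = mul-cong≈ (suc K) (c (suc K)) N (mulAll-cong≈ c K N f≈g)

mulAll-cong : ∀ c K {f g} → f ≗ g → mulAll c K f ≗ mulAll c K g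
mulAll-cong c K f≗g N = mulAll-cong≈ c K N (λ t _ → f≗g t) N ≤-refl

mulAll-congˡ : ∀ {c d : Weights} K f → (∀ v → v ≤ K → c v ≗ d v) →
  mulAll c K f ≗ mulAll d K f
mulAll-congˡ         zero    f c≗d N = refl
mulAll-congˡ {c} {d} (suc K) f c≗d N =
  trans (mul-congˡ (suc K) (mulAll c K f) (c≗d (suc K) ≤-refl) N)
        (mul-cong (suc K) (d (suc K)) (mulAll-congˡ K f (λ v v≤K → c≗d v (m≤n⇒m≤1+n v≤K))) N)

mulAll-mul : ∀ c K w d f → mulAll c K (mul (suc w) d f) ≗ mul (suc w) d (mulAll c K f)
mulAll-mul c zero    w d f N = refl
mulAll-mul c (suc K) w d f N = trans (mul-cong (suc K) (c (suc K)) (mulAll-mul c K w d f) N)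
                                     (mul-comm K w (c (suc K)) d (mulAll c K f) N)

mulAll-comm : ∀ c K d K′ f → mulAll c K (mulAll d K′ f) ≗ mulAll d K′ (mulAll c K f)
mulAll-comm c K d zero     f N = refl
mulAll-comm c K d (suc K′) f N = trans (mulAll-mul c K K′ (d (suc K′)) (mulAll d K′ f) N)
                                       (mul-cong (suc K′) (d (suc K′)) (mulAll-comm c K d K′ f) N)

mulAll-low : ∀ c N f → (∀ v → c v 0 ≡ 1) → ∀ r → mulAll c (r + N) f ≈[ N ] mulAll c N f
mulAll-low c N f c0≡1 zero    t t≤N = refl
mulAll-low c N f c0≡1 (suc r) t t≤N = begin
  mul (suc (r + N)) (c (suc (r + N))) (mulAll c (r + N) f) t
    ≡⟨ mul-low (r + N) (c (suc (r + N))) (mulAll c (r + N) f) t t<1+r+N ⟩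
  c (suc (r + N)) 0 * mulAll c (r + N) f t
    ≡⟨ cong (_* mulAll c (r + N) f t) (c0≡1 (suc (r + N))) ⟩
  1 * mulAll c (r + N) f t
    ≡⟨ *-identityˡ _ ⟩
  mulAll c (r + N) f t
    ≡⟨ mulAll-low c N f c0≡1 r t t≤N ⟩
  mulAll c N f t ∎
  where
  open ≡-Reasoning
  t<1+r+N : t < suc (r + N)
  t<1+r+N = s≤s (≤-trans t≤N (m≤n+m N r))

mulAll-cancel : ∀ c K {x y} N → (∀ v → c v 0 ≡ 1) →
  mulAll c K x ≈[ N ] mulAll c K y → x ≈[ N ] y
mulAll-cancel c zero    N c0≡1 eq = eq
mulAll-cancel c (suc K) N c0≡1 eq =
  mulAll-cancel c K N c0≡1 (mul-cancel K (c (suc K)) N (c0≡1 (suc K)) eq)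

mulAll-split : ∀ (b : ℕ → Bool) c K f →
  mulAll c K f
    ≗ mulAll (λ v → if b v then δ₀ else c v) K (mulAll (λ v → if b v then c v else δ₀) K f)
mulAll-split b c zero    f N = refl
mulAll-split b c (suc K) f N with b (suc K)
... | true  = trans (mul-cong (suc K) (c (suc K)) (mulAll-split b c K f) N)
  (sym (trans (mul-δ₀ K (mulAll outer K (mul (suc K) (c (suc K)) (mulAll inner K f))) N)
              (mulAll-mul outer K K (c (suc K)) (mulAll inner K f) N)))
  where
  outer = λ v → if b v then δ₀ else c v
  inner = λ v → if b v then c v else δ₀
... | false = trans (mul-cong (suc K) (c (suc K)) (mulAll-split b c K f) N)
  (mul-cong (suc K) (c (suc K)) (mulAll-cong outer K (λ t → sym (mul-δ₀ K (mulAll inner K f) t))) N)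
  where
  outer = λ v → if b v then δ₀ else c v
  inner = λ v → if b v then c v else δ₀

set : Weights → ℕ → (ℕ → ℕ) → Weights
set c j a v = if does (v ≟ j) then a else c v

set-≡ : ∀ c j a → set c j a j ≡ a
set-≡ c j a = cong (λ b → if b then a else c j) (dec-true (j ≟ j) refl)

set-≢ : ∀ c j a v → v ≢ j → set c j a v ≡ c v
set-≢ c j a v v≢j = cong (λ b → if b then a else c v) (dec-false (v ≟ j) v≢j)

set-set : ∀ c j a b v → set (set c j a) j b v ≡ set c j b v
set-set c j a b v with v ≟ j
... | yes refl = trans (set-≡ (set c j a) j b) (sym (set-≡ c j b))
... | no  v≢j  =
  trans (set-≢ (set c j a) j b v v≢j) (trans (set-≢ c j a v v≢j) (sym (set-≢ c j b v v≢j)))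

mulAll-extract : ∀ c K i f → suc i ≤ K →
  mulAll c K f ≗ mul (suc i) (c (suc i)) (mulAll (set c (suc i) δ₀) K f)
mulAll-extract c (suc K) i f i<K N with K ≟ i
... | yes refl = mul-cong (suc K) (c (suc K)) (λ t → sym (begin
  mul (suc K) (set c (suc K) δ₀ (suc K)) (mulAll c′ K f) t
    ≡⟨ cong (λ a → mul (suc K) a (mulAll c′ K f) t) (set-≡ c (suc K) δ₀) ⟩
  mul (suc K) δ₀ (mulAll c′ K f) t
    ≡⟨ mul-δ₀ K (mulAll c′ K f) t ⟩
  mulAll c′ K f t
    ≡⟨ mulAll-congˡ K f (λ v v≤K → cong-app (set-≢ c (suc K) δ₀ v (<⇒≢ (s≤s v≤K)))) t ⟩
  mulAll c K f t ∎)) N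
  where
  open ≡-Reasoning
  c′ = set c (suc K) δ₀
... | no K≢i = begin
  mul (suc K) (c (suc K)) (mulAll c K f) N
    ≡⟨ mul-cong (suc K) (c (suc K)) (mulAll-extract c K i f i<K′) N ⟩
  mul (suc K) (c (suc K)) (mul (suc i) (c (suc i)) (mulAll c′ K f)) N
    ≡⟨ mul-comm K i (c (suc K)) (c (suc i)) (mulAll c′ K f) N ⟩
  mul (suc i) (c (suc i)) (mul (suc K) (c (suc K)) (mulAll c′ K f)) N
    ≡⟨ mul-cong (suc i) (c (suc i)) (mul-congˡ (suc K) (mulAll c′ K f) (cong-app c′≡c)) N ⟨
  mul (suc i) (c (suc i)) (mul (suc K) (c′ (suc K)) (mulAll c′ K f)) N ∎
  where
  open ≡-Reasoning
  c′ = set c (suc i) δ₀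
  i<K′ : suc i ≤ K
  i<K′ = ≤∧≢⇒< (≤-pred i<K) (K≢i ∘ sym)
  c′≡c : c′ (suc K) ≡ c (suc K)
  c′≡c = set-≢ c (suc i) δ₀ (suc K) (K≢i ∘ suc-injective)

mulAll-set : ∀ c i a K f → suc i ≤ K →
  mulAll (set c (suc i) a) K f ≗ mul (suc i) a (mulAll (set c (suc i) δ₀) K f)
mulAll-set c i a K f i<K N = begin
  mulAll (set c j a) K f N
    ≡⟨ mulAll-extract (set c j a) K i f i<K N ⟩
  mul j (set c j a j) (mulAll (set (set c j a) j δ₀) K f) N
    ≡⟨ cong (λ b → mul j b (mulAll (set (set c j a) j δ₀) K f) N) (set-≡ c j a) ⟩
  mul j a (mulAll (set (set c j a) j δ₀) K f) N
    ≡⟨ mul-cong j a (mulAll-congˡ K f (λ v _ → cong-app (set-set c j a δ₀ v))) N ⟩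
  mul j a (mulAll (set c j δ₀) K f) N ∎
  where
  open ≡-Reasoning
  j = suc i

module Glaisher (p′ : ℕ) where

  p : ℕ
  p = suc p′

  fewerThanP : Weights
  fewerThanP _ = below p

  noMultiplesOfP : Weights
  noMultiplesOfP v = if does (p ∣? v) then δ₀ else ones

  onlyMultiplesOfP : Weights
  onlyMultiplesOfP v = if does (p ∣? v) then ones else δ₀

  noMultiplesOfP-∣ : ∀ v → p ∣ₙ v → noMultiplesOfP v ≡ δ₀
  noMultiplesOfP-∣ v p∣v = cong (λ b → if b then δ₀ else ones) (dec-true (p ∣? v) p∣v)

  noMultiplesOfP-∤ : ∀ v → ¬ p ∣ₙ v → noMultiplesOfP v ≡ ones
  noMultiplesOfP-∤ v p∤v = cong (λ b → if b then δ₀ else ones) (dec-false (p ∣? v) p∤v)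

  onlyMultiplesOfP-∣ : ∀ v → p ∣ₙ v → onlyMultiplesOfP v ≡ ones
  onlyMultiplesOfP-∣ v p∣v = cong (λ b → if b then ones else δ₀) (dec-true (p ∣? v) p∣v)

  onlyMultiplesOfP-∤ : ∀ v → ¬ p ∣ₙ v → onlyMultiplesOfP v ≡ δ₀
  onlyMultiplesOfP-∤ v p∤v = cong (λ b → if b then ones else δ₀) (dec-false (p ∣? v) p∤v)

  onlyMultiplesOfP-0 : ∀ v → onlyMultiplesOfP v 0 ≡ 1
  onlyMultiplesOfP-0 v with p ∣? v
  ... | yes p∣v = cong-app (onlyMultiplesOfP-∣ v p∣v) 0
  ... | no  p∤v = cong-app (onlyMultiplesOfP-∤ v p∤v) 0

  onlyMultiplesOfP-step : ∀ K f →
    mulAll onlyMultiplesOfP (p * suc K) f ≗ mul (p * suc K) ones (mulAll onlyMultiplesOfP (p * K) f)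
  onlyMultiplesOfP-step K f t = begin
    mulAll onlyMultiplesOfP (p * suc K) f t
      ≡⟨ cong (λ n → mulAll onlyMultiplesOfP n f t) (*-suc p K) ⟩
    mul (suc top) (onlyMultiplesOfP (suc top)) (mulAll onlyMultiplesOfP top f) t
      ≡⟨ mul-congˡ (suc top) (mulAll onlyMultiplesOfP top f)
                   (cong-app (onlyMultiplesOfP-∣ (suc top) p∣1+top)) t ⟩
    mul (suc top) ones (mulAll onlyMultiplesOfP top f) t
      ≡⟨ mul-cong (suc top) ones (skip p′ ≤-refl) t ⟩
    mul (suc top) ones (mulAll onlyMultiplesOfP (p * K) f) t
      ≡⟨ cong (λ n → mul n ones (mulAll onlyMultiplesOfP (p * K) f) t) (*-suc p K) ⟨
    mul (p * suc K) ones (mulAll onlyMultiplesOfP (p * K) f) t ∎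
    where
    open ≡-Reasoning
    top = p′ + p * K
    p∣1+top : p ∣ₙ suc top
    p∣1+top = subst (p ∣ₙ_) (*-suc p K) (m∣m*n (suc K))
    p∤ : ∀ r → r < p′ → ¬ (p ∣ₙ suc r + p * K)
    p∤ r r<p′ p∣ = <⇒≱ (s≤s r<p′) (∣⇒≤ (∣m+n∣m⇒∣n p∣1+r+pK (m∣m*n K)))
      where
      p∣1+r+pK = subst (p ∣ₙ_) (+-comm (suc r) (p * K)) p∣
    skip : ∀ r → r ≤ p′ →
      mulAll onlyMultiplesOfP (r + p * K) f ≗ mulAll onlyMultiplesOfP (p * K) f
    skip zero    _     s = refl
    skip (suc r) r<p′ s = begin
      mul (suc q) (onlyMultiplesOfP (suc q)) (mulAll onlyMultiplesOfP q f) s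
        ≡⟨ mul-congˡ (suc q) (mulAll onlyMultiplesOfP q f)
                     (cong-app (onlyMultiplesOfP-∤ (suc q) (p∤ r r<p′))) s ⟩
      mul (suc q) δ₀ (mulAll onlyMultiplesOfP q f) s
        ≡⟨ mul-δ₀ q (mulAll onlyMultiplesOfP q f) s ⟩
      mulAll onlyMultiplesOfP q f s
        ≡⟨ skip r (≤-trans (n≤1+n r) r<p′) s ⟩
      mulAll onlyMultiplesOfP (p * K) f s ∎
      where
      q = r + p * K

  fewerThanP-onlyMultiplesOfP : ∀ K f →
    mulAll fewerThanP K (mulAll onlyMultiplesOfP (p * K) f) ≗ mulAll unrestricted K f
  fewerThanP-onlyMultiplesOfP zero    f N = cong (λ n → mulAll onlyMultiplesOfP n f N) (*-zeroʳ p)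
  fewerThanP-onlyMultiplesOfP (suc K) f N = begin
    mul (suc K) (below p) (mulAll fewerThanP K (mulAll onlyMultiplesOfP (p * suc K) f)) N
      ≡⟨ mul-cong (suc K) (below p) (mulAll-cong fewerThanP K (onlyMultiplesOfP-step K f)) N ⟩
    mul (suc K) (below p) (mulAll fewerThanP K (mul (p * suc K) ones M)) N
      ≡⟨ mul-cong (suc K) (below p) (mulAll-mul fewerThanP K (K + p′ * suc K) ones M) N ⟩
    mul (suc K) (below p) (mul (p * suc K) ones (mulAll fewerThanP K M)) N
      ≡⟨ mul-cong (suc K) (below p) (mul-cong (p * suc K) ones (fewerThanP-onlyMultiplesOfP K f)) N ⟩
    mul (suc K) (below p) (mul (p * suc K) ones (mulAll unrestricted K f)) N
      ≡⟨ glaisher-factor K p′ (mulAll unrestricted K f) N ⟩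
    mul (suc K) ones (mulAll unrestricted K f) N ∎
    where
    open ≡-Reasoning
    M = mulAll onlyMultiplesOfP (p * K) f

  glaisher : ∀ N → mulAll fewerThanP N δ₀ ≈[ N ] mulAll noMultiplesOfP N δ₀
  glaisher N = mulAll-cancel onlyMultiplesOfP N N onlyMultiplesOfP-0 λ t t≤N → begin
    mulAll onlyMultiplesOfP N (mulAll fewerThanP N δ₀) t
      ≡⟨ mulAll-comm onlyMultiplesOfP N fewerThanP N δ₀ t ⟩
    mulAll fewerThanP N (mulAll onlyMultiplesOfP N δ₀) t
      ≡⟨ mulAll-cong≈ fewerThanP N N stable t t≤N ⟨
    mulAll fewerThanP N (mulAll onlyMultiplesOfP (p * N) δ₀) t
      ≡⟨ fewerThanP-onlyMultiplesOfP N δ₀ t ⟩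
    mulAll unrestricted N δ₀ t
      ≡⟨ mulAll-split (λ v → does (p ∣? v)) unrestricted N δ₀ t ⟩
    mulAll noMultiplesOfP N (mulAll onlyMultiplesOfP N δ₀) t
      ≡⟨ mulAll-comm noMultiplesOfP N onlyMultiplesOfP N δ₀ t ⟩
    mulAll onlyMultiplesOfP N (mulAll noMultiplesOfP N δ₀) t ∎
    where
    open ≡-Reasoning
    stable : mulAll onlyMultiplesOfP (p * N) δ₀ ≈[ N ] mulAll onlyMultiplesOfP N δ₀
    stable t t≤N = trans (cong (λ n → mulAll onlyMultiplesOfP n δ₀ t) (+-comm N (p′ * N)))
                         (mulAll-low onlyMultiplesOfP N δ₀ onlyMultiplesOfP-0 (p′ * N) t t≤N)

mult-head-≡ : ∀ v l → mult v (v ∷ l) ≡ suc (mult v l)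
mult-head-≡ v l = cong length (filter-accept (_≟ v) refl)

mult-head-≢ : ∀ a v l → a ≢ v → mult v (a ∷ l) ≡ mult v l
mult-head-≢ a v l a≢v = cong length (filter-reject (_≟ v) a≢v)

mult-∷ : ∀ a v l → mult v (a ∷ l) ≡ when (a ≟ v) 1 + mult v l
mult-∷ a v l with a ≟ v
... | yes refl = mult-head-≡ a l
... | no  a≢v  = mult-head-≢ a v l a≢v

mult-replicate-≡ : ∀ m v l → mult v (replicate m v ++ l) ≡ m + mult v l
mult-replicate-≡ zero    v l = refl
mult-replicate-≡ (suc m) v l =
  trans (mult-head-≡ v (replicate m v ++ l)) (cong suc (mult-replicate-≡ m v l))

mult-replicate-≢ : ∀ m w v l → w ≢ v → mult v (replicate m w ++ l) ≡ mult v l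
mult-replicate-≢ zero    w v l w≢v = refl
mult-replicate-≢ (suc m) w v l w≢v = trans (mult-head-≢ w v _ w≢v) (mult-replicate-≢ m w v l w≢v)

mult-above : ∀ v l → All (_< v) l → mult v l ≡ 0
mult-above v []      []          = refl
mult-above v (a ∷ l) (a<v ∷ l<v) = trans (mult-head-≢ a v l (<⇒≢ a<v)) (mult-above v l l<v)

mult-replicate-top : ∀ K m y → All (_≤ K) y → mult (suc K) (replicate m (suc K) ++ y) ≡ m
mult-replicate-top K m y y≤K = trans (mult-replicate-≡ m (suc K) y)
  (trans (cong (m +_) (mult-above (suc K) y (All-map s≤s y≤K))) (+-identityʳ m))

mult≢0⇒∈ : ∀ v l → mult v l ≢ 0 → v ∈ l
mult≢0⇒∈ v []      mult≢0 = contradiction refl mult≢0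
mult≢0⇒∈ v (a ∷ l) mult≢0 with a ≟ v
... | yes refl = here refl
... | no  a≢v  = there (mult≢0⇒∈ v l (mult≢0 ∘ trans (mult-head-≢ a v l a≢v)))

∉⇒mult≡0 : ∀ v l → ¬ v ∈ l → mult v l ≡ 0
∉⇒mult≡0 v l v∉l = decidable-stable (mult v l ≟ 0) (v∉l ∘ mult≢0⇒∈ v l)

∈⇒mult≢0 : ∀ v l → v ∈ l → mult v l ≢ 0
∈⇒mult≢0 v (a ∷ l) v∈ with a ≟ v
... | yes refl = λ mult≡0 → 1+n≢0 (trans (sym (mult-head-≡ a l)) mult≡0)
∈⇒mult≢0 v (a ∷ l) (here v≡a)  | no a≢v = contradiction (sym v≡a) a≢v
∈⇒mult≢0 v (a ∷ l) (there v∈l) | no a≢v =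
  ∈⇒mult≢0 v l v∈l ∘ trans (sym (mult-head-≢ a v l a≢v))

weight : Weights → ℕ → List ℕ → ℕ
weight c zero    x = 1
weight c (suc K) x = c (suc K) (mult (suc K) x) * weight c K x

weight-cong : ∀ c K x y → (∀ v → v ≤ K → mult v x ≡ mult v y) → weight c K x ≡ weight c K y
weight-cong c zero    x y eq = refl
weight-cong c (suc K) x y eq =
  cong₂ _*_ (cong (c (suc K)) (eq (suc K) ≤-refl))
            (weight-cong c K x y (λ v v≤K → eq v (m≤n⇒m≤1+n v≤K)))

weight-congˡ : ∀ {c d : Weights} K x → (∀ v → 1 ≤ v → v ≤ K → c v ≗ d v) →
  weight c K x ≡ weight d K x
weight-congˡ zero    x c≗d = refl
weight-congˡ (suc K) x c≗d =
  cong₂ _*_ (c≗d (suc K) (s≤s z≤n) ≤-refl _)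
            (weight-congˡ K x (λ v 1≤v v≤K → c≗d v 1≤v (m≤n⇒m≤1+n v≤K)))

weight-replicate : ∀ c K m y → All (_≤ K) y →
  weight c (suc K) (replicate m (suc K) ++ y) ≡ c (suc K) m * weight c K y
weight-replicate c K m y y≤K = cong₂ _*_ (cong (c (suc K)) (mult-replicate-top K m y y≤K))
  (weight-cong c K _ y (λ v v≤K → mult-replicate-≢ m (suc K) v y (<⇒≢ (s≤s v≤K) ∘ sym)))

weight-≡1 : ∀ c K x → (∀ v → 1 ≤ v → v ≤ K → c v (mult v x) ≡ 1) → weight c K x ≡ 1
weight-≡1 c zero    x all≡1 = refl
weight-≡1 c (suc K) x all≡1 =
  cong₂ _*_ (all≡1 (suc K) (s≤s z≤n) ≤-refl)
            (weight-≡1 c K x (λ v 1≤v v≤K → all≡1 v 1≤v (m≤n⇒m≤1+n v≤K)))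

weight-≢0 : ∀ c K x → weight c K x ≢ 0 → ∀ v → 1 ≤ v → v ≤ K → c v (mult v x) ≢ 0
weight-≢0 c zero    x _   v 1≤v v≤0   _    = contradiction (≤-trans 1≤v v≤0) (λ ())
weight-≢0 c (suc K) x w≢0 v 1≤v v≤1+K cv≡0 with m≤n⇒m<n∨m≡n v≤1+K
... | inj₁ v<1+K = weight-≢0 c K x (w≢0 ∘ top*) v 1≤v (≤-pred v<1+K) cv≡0
  where
  top* : weight c K x ≡ 0 → weight c (suc K) x ≡ 0
  top* w≡0 = trans (cong (c (suc K) (mult (suc K) x) *_) w≡0) (*-zeroʳ (c (suc K) (mult (suc K) x)))
... | inj₂ refl  = w≢0 (cong (_* weight c K x) cv≡0)

-- Enumerating partitions

BoundedPartition : ℕ → ℕ → List ℕ → Set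
BoundedPartition K N x = IsPartition N x × All (_≤ K) x

parts≤sum : ∀ x → All (_≤ sum x) x
parts≤sum []      = []
parts≤sum (a ∷ x) =
  m≤m+n a (sum x) ∷ All-map (λ b≤Σx → ≤-trans b≤Σx (m≤n+m (sum x) a)) (parts≤sum x)

IsPartition⇒BoundedPartition : ∀ n x → IsPartition n x → BoundedPartition n n x
IsPartition⇒BoundedPartition n x x⊢n@(_ , _ , Σx≡n) =
  x⊢n , subst (λ m → All (_≤ m) x) Σx≡n (parts≤sum x)

concatBelow : ℕ → (ℕ → List (List ℕ)) → List (List ℕ)
concatBelow zero    F = []
concatBelow (suc M) F = F 0 ++ concatBelow M (F ∘ suc)

∈-concatBelow⁻ : ∀ M F {x} → x ∈ concatBelow M F → ∃[ m ] (m < M × x ∈ F m)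
∈-concatBelow⁻ (suc M) F x∈ with ∈-++⁻ (F 0) x∈
... | inj₁ x∈F0 = 0 , s≤s z≤n , x∈F0
... | inj₂ x∈rest with ∈-concatBelow⁻ M (F ∘ suc) x∈rest
...   | m , m<M , x∈Fm = suc m , s≤s m<M , x∈Fm

∈-concatBelow⁺ : ∀ M F {x} m → m < M → x ∈ F m → x ∈ concatBelow M F
∈-concatBelow⁺ (suc M) F zero    _         x∈ = ∈-++⁺ˡ x∈
∈-concatBelow⁺ (suc M) F (suc m) (s≤s m<M) x∈ =
  ∈-++⁺ʳ (F 0) (∈-concatBelow⁺ M (F ∘ suc) m m<M x∈)

concatBelow-unique : ∀ M F → (∀ m → Unique (F m)) →
  (∀ m m′ {x} → x ∈ F m → x ∈ F m′ → m ≡ m′) → Unique (concatBelow M F)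
concatBelow-unique zero    F unique disjoint = []
concatBelow-unique (suc M) F unique disjoint = Unique.++⁺ (unique 0) rest-unique λ (x∈F0 , x∈rest) →
  let (m , _ , x∈Fm) = ∈-concatBelow⁻ M (F ∘ suc) x∈rest
  in 0≢1+n (disjoint 0 (suc m) x∈F0 x∈Fm)
  where
  rest-unique : Unique (concatBelow M (F ∘ suc))
  rest-unique = concatBelow-unique M (F ∘ suc) (unique ∘ suc)
    (λ m m′ x∈ x∈′ → suc-injective (disjoint (suc m) (suc m′) x∈ x∈′))

sum-concatBelow : ∀ (g : List ℕ → ℕ) M F →
  sum (map g (concatBelow M F)) ≡ Σ< M (λ m → sum (map g (F m)))
sum-concatBelow g zero    F = refl
sum-concatBelow g (suc M) F = begin
  sum (map g (F 0 ++ concatBelow M (F ∘ suc)))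
    ≡⟨ cong sum (map-++ g (F 0) _) ⟩
  sum (map g (F 0) ++ map g (concatBelow M (F ∘ suc)))
    ≡⟨ sum-++ (map g (F 0)) _ ⟩
  sum (map g (F 0)) + sum (map g (concatBelow M (F ∘ suc)))
    ≡⟨ cong (sum (map g (F 0)) +_) (sum-concatBelow g M (F ∘ suc)) ⟩
  Σ< (suc M) (λ m → sum (map g (F m))) ∎
  where open ≡-Reasoning

whenL : ∀ {P : Set} → Dec P → List (List ℕ) → List (List ℕ)
whenL (yes _) xs = xs
whenL (no _)  _  = []

partitions : ℕ → ℕ → List (List ℕ)
partitionsWith : ℕ → ℕ → ℕ → List (List ℕ)
partitions zero    zero    = [] ∷ []
partitions zero    (suc _) = []
partitions (suc K) N       = concatBelow (suc N) (partitionsWith K N)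
partitionsWith K N m =
  whenL (m * suc K ≤? N) (map (replicate m (suc K) ++_) (partitions K (N ∸ m * suc K)))

∈-partitionsWith⁻ : ∀ K N m {x} → x ∈ partitionsWith K N m →
  m * suc K ≤ N × ∃[ y ] (y ∈ partitions K (N ∸ m * suc K) × x ≡ replicate m (suc K) ++ y)
∈-partitionsWith⁻ K N m x∈ with m * suc K ≤? N
... | yes mv≤N = mv≤N , ∈-map⁻ (replicate m (suc K) ++_) x∈

sum-replicate : ∀ m w → sum (replicate m w) ≡ m * w
sum-replicate zero    w = refl
sum-replicate (suc m) w = cong (w +_) (sum-replicate m w)

Linked-replicate : ∀ K m y → All (_≤ K) y → Linked _≥_ y → Linked _≥_ (replicate m (suc K) ++ y)
Linked-replicate K zero          y       _         y↓ = y↓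
Linked-replicate K (suc zero)    []      _         _  = [-]
Linked-replicate K (suc zero)    (a ∷ y) (a≤K ∷ _) y↓ = m≤n⇒m≤1+n a≤K ∷ y↓
Linked-replicate K (suc (suc m)) y       y≤K       y↓ =
  ≤-refl ∷ Linked-replicate K (suc m) y y≤K y↓

partitions-sound : ∀ K N x → x ∈ partitions K N → BoundedPartition K N x
partitions-sound zero    zero .[] (here refl) = ([] , [] , refl) , []
partitions-sound (suc K) N    x   x∈ with ∈-concatBelow⁻ (suc N) (partitionsWith K N) x∈
... | m , _ , x∈block with ∈-partitionsWith⁻ K N m x∈block
... | mv≤N , y , y∈ , refl with partitions-sound K (N ∸ m * suc K) y y∈
... | (y>0 , y↓ , Σy) , y≤K =
  ( All.++⁺ (All.replicate⁺ m (s≤s z≤n)) y>0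
  , Linked-replicate K m y y≤K y↓
  , trans (sum-++ (replicate m (suc K)) y)
          (trans (cong₂ _+_ (sum-replicate m (suc K)) Σy) (m+[n∸m]≡n mv≤N)) )
  , All.++⁺ (All.replicate⁺ m ≤-refl) (All-map m≤n⇒m≤1+n y≤K)

Linked-head : ∀ a x → Linked _≥_ (a ∷ x) → All (_≤ a) x
Linked-head a []      _         = []
Linked-head a (b ∷ x) (b≤a ∷ l) =
  b≤a ∷ All-map (λ c≤b → ≤-trans c≤b b≤a) (Linked-head b x l)

split-top : ∀ K x → Linked _≥_ x → All (_≤ suc K) x →
  ∃[ m ] ∃[ y ] (x ≡ replicate m (suc K) ++ y × All (_≤ K) y × Linked _≥_ y)
split-top K []      _ _                   = 0 , [] , refl , [] , []
split-top K (a ∷ x) l (a≤1+K ∷ x≤1+K) with m≤n⇒m<n∨m≡n a≤1+K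
... | inj₁ (s≤s a≤K) =
  0 , a ∷ x , refl , a≤K ∷ All-map (λ b≤a → ≤-trans b≤a a≤K) (Linked-head a x l) , l
... | inj₂ refl with split-top K x (Linked.tail l) x≤1+K
...   | m , y , refl , y≤K , y↓ = suc m , y , refl , y≤K , y↓

partitions-complete : ∀ K N x → BoundedPartition K N x → x ∈ partitions K N
partitions-complete zero    .0 []      ((_ , _ , refl) , _) = here refl
partitions-complete zero    N  (a ∷ x) ((a>0 ∷ _ , _) , a≤0 ∷ _) =
  contradiction (≤-trans a>0 a≤0) (λ ())
partitions-complete (suc K) N  x       ((x>0 , x↓ , Σx) , x≤1+K) with split-top K x x↓ x≤1+K
... | m , y , refl , y≤K , y↓ =
  ∈-concatBelow⁺ (suc N) (partitionsWith K N) m (s≤s (≤-trans (m≤m*n m (suc K)) mv≤N)) x∈block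
  where
  total : m * suc K + sum y ≡ N
  total = trans (cong (_+ sum y) (sym (sum-replicate m (suc K))))
                (trans (sym (sum-++ (replicate m (suc K)) y)) Σx)
  mv≤N : m * suc K ≤ N
  mv≤N = subst (m * suc K ≤_) total (m≤m+n _ _)
  Σy : sum y ≡ N ∸ m * suc K
  Σy = trans (sym (m+n∸m≡n (m * suc K) (sum y))) (cong (_∸ m * suc K) total)
  y⊢N∸mv : BoundedPartition K (N ∸ m * suc K) y
  y⊢N∸mv = (All.++⁻ʳ (replicate m (suc K)) x>0 , y↓ , Σy) , y≤K
  x∈block : replicate m (suc K) ++ y ∈ partitionsWith K N m
  x∈block with m * suc K ≤? N
  ... | yes _    = ∈-map⁺ (replicate m (suc K) ++_) (partitions-complete K _ y y⊢N∸mv)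
  ... | no mv≰N = contradiction mv≤N mv≰N

mult-partitionsWith : ∀ K N m {x} → x ∈ partitionsWith K N m → mult (suc K) x ≡ m
mult-partitionsWith K N m x∈ with ∈-partitionsWith⁻ K N m x∈
... | _ , y , y∈ , refl = mult-replicate-top K m y (proj₂ (partitions-sound K _ y y∈))

partitions-unique : ∀ K N → Unique (partitions K N)
partitions-unique zero    zero    = [] ∷ []
partitions-unique zero    (suc N) = []
partitions-unique (suc K) N = concatBelow-unique (suc N) (partitionsWith K N) block-unique
  λ m m′ x∈ x∈′ →
    trans (sym (mult-partitionsWith K N m x∈)) (mult-partitionsWith K N m′ x∈′)
  where
  block-unique : ∀ m → Unique (partitionsWith K N m)
  block-unique m with m * suc K ≤? N
  ... | yes _ = Unique.map⁺ (++-cancelˡ (replicate m (suc K)) _ _) (partitions-unique K (N ∸ m * suc K))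
  ... | no _  = []

sum-map-* : ∀ {A : Set} k (f : A → ℕ) xs → sum (map (λ x → k * f x) xs) ≡ k * sum (map f xs)
sum-map-* k f []       = sym (*-zeroʳ k)
sum-map-* k f (x ∷ xs) = trans (cong (k * f x +_) (sum-map-* k f xs)) (sym (*-distribˡ-+ k (f x) _))

sum-weight-partitions : ∀ c K N → sum (map (weight c K) (partitions K N)) ≡ mulAll c K δ₀ N
sum-weight-partitions c zero    zero    = refl
sum-weight-partitions c zero    (suc N) = refl
sum-weight-partitions c (suc K) N =
  trans (sum-concatBelow (weight c (suc K)) (suc N) (partitionsWith K N)) (Σ<-cong′ (suc N) block)
  where
  block : ∀ m → sum (map (weight c (suc K)) (partitionsWith K N m))
                ≡ mul-term (suc K) (c (suc K)) (mulAll c K δ₀) N m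
  block m with m * suc K ≤? N
  ... | no _  = refl
  ... | yes _ = begin
    sum (map (weight c (suc K)) (map (replicate m (suc K) ++_) ys))
      ≡⟨ cong sum (map-∘ ys) ⟨
    sum (map (weight c (suc K) ∘ (replicate m (suc K) ++_)) ys)
      ≡⟨ cong sum (map-cong-local (tabulate λ {y} y∈ →
           weight-replicate c K m y (proj₂ (partitions-sound K _ y y∈)))) ⟩
    sum (map (λ y → c (suc K) m * weight c K y) ys)
      ≡⟨ sum-map-* (c (suc K) m) (weight c K) ys ⟩
    c (suc K) m * sum (map (weight c K) ys)
      ≡⟨ cong (c (suc K) m *_) (sum-weight-partitions c K (N ∸ m * suc K)) ⟩
    c (suc K) m * mulAll c K δ₀ (N ∸ m * suc K) ∎
    where
    open ≡-Reasoning
    ys = partitions K (N ∸ m * suc K)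

sum-map-Σ< : ∀ {A : Set} (xs : List A) M (G : ℕ → A → ℕ) →
  sum (map (λ x → Σ< M (λ i → G i x)) xs) ≡ Σ< M (λ i → sum (map (G i) xs))
sum-map-Σ< []       M G = sym (Σ<-zero M _ (λ _ _ → refl))
sum-map-Σ< (x ∷ xs) M G = trans (cong (Σ< M (λ i → G i x) +_) (sum-map-Σ< xs M G))
                                (sym (Σ<-+ M (λ i → G i x) (λ i → sum (map (G i) xs))))

sum-map-when : ∀ {A P : Set} (P? : Dec P) (f : A → ℕ) xs →
  sum (map (λ x → when P? (f x)) xs) ≡ when P? (sum (map f xs))
sum-map-when (yes _) f xs       = refl
sum-map-when (no _)  f []       = refl
sum-map-when (no ¬p) f (x ∷ xs) = sum-map-when (no ¬p) f xs

length≡sum-map-1 : ∀ {A : Set} (xs : List A) → length xs ≡ sum (map (λ _ → 1) xs)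
length≡sum-map-1 []       = refl
length≡sum-map-1 (x ∷ xs) = cong suc (length≡sum-map-1 xs)

sum-filter : ∀ {P : List ℕ → Set} (P? : Decidable P) (f : List ℕ → ℕ) xs →
  sum (map f (filter P? xs)) ≡ sum (map (λ x → when (P? x) (f x)) xs)
sum-filter P? f []       = refl
sum-filter P? f (x ∷ xs) with P? x
... | yes _ = cong (f x +_) (sum-filter P? f xs)
... | no _  = sum-filter P? f xs

sum-⊆-unique : ∀ (L V : List (List ℕ)) (f : List ℕ → ℕ) → Unique L → Unique V →
  (∀ {x} → x ∈ L → x ∈ V) → sum (map f L) ≡ sum (map (λ x → when (x ∈? L) (f x)) V)
sum-⊆-unique L V f L! V! L⊆V = trans (sum-↭ (↭.map⁺ f L↭V∩L)) (sum-filter (_∈? L) f V)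
  where
  L↭V∩L = ∼bag⇒↭ (unique∧set⇒bag L! (Unique.filter⁺ (_∈? L) V!)
    (mk⇔ (λ x∈L → ∈-filter⁺ (_∈? L) (L⊆V x∈L) x∈L)
         (λ x∈ → proj₂ (∈-filter⁻ (_∈? L) {xs = V} x∈))))

Enumerates : ℕ → List (List ℕ) → (List ℕ → Set) → Set
Enumerates n L P = ∀ λs → (λs ∈ L) ⇔ (IsPartition n λs × P λs)

module Counting (p′ : ℕ) where

  open Glaisher p′

  -- Weighted by onlyPart j, a partition counts iff j is its only part divisible by p; weighted by
  -- countPart j, it counts mult j times provided every part occurs fewer than p times.
  onlyPart countPart excessPart : ℕ → Weights
  onlyPart   j = set noMultiplesOfP j (atLeast 1)
  countPart  j = set fewerThanP j (multBelow p)
  excessPart j = set fewerThanP j (atLeast p)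

  onlyPart-≡ : ∀ j → onlyPart j j ≡ atLeast 1
  onlyPart-≡ j = set-≡ noMultiplesOfP j (atLeast 1)

  onlyPart-≢ : ∀ j v → v ≢ j → onlyPart j v ≡ noMultiplesOfP v
  onlyPart-≢ j v = set-≢ noMultiplesOfP j (atLeast 1) v

  set-noMultiplesOfP : ∀ j → p ∣ₙ j → ∀ v → set noMultiplesOfP j δ₀ v ≡ noMultiplesOfP v
  set-noMultiplesOfP j p∣j v with v ≟ j
  ... | yes refl = trans (set-≡ noMultiplesOfP v δ₀) (sym (noMultiplesOfP-∣ v p∣j))
  ... | no  v≢j  = set-≢ noMultiplesOfP j δ₀ v v≢j

  onlyPart≡countPart+p*excessPart : ∀ i N → suc i ≤ N → p ∣ₙ suc i →
    mulAll (onlyPart (suc i)) N δ₀ N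
      ≡ mulAll (countPart (suc i)) N δ₀ N + p * mulAll (excessPart (suc i)) N δ₀ N
  onlyPart≡countPart+p*excessPart i N j≤N p∣j = begin
    mulAll (onlyPart j) N δ₀ N
      ≡⟨ mulAll-set noMultiplesOfP i (atLeast 1) N δ₀ j≤N N ⟩
    mul j (atLeast 1) (mulAll (set noMultiplesOfP j δ₀) N δ₀) N
      ≡⟨ mul-cong j (atLeast 1) (mulAll-congˡ N δ₀ λ v _ → cong-app (set-noMultiplesOfP j p∣j v)) N ⟩
    mul j (atLeast 1) (mulAll noMultiplesOfP N δ₀) N
      ≡⟨ mul-cong≈ j (atLeast 1) N (glaisher N) N ≤-refl ⟨
    mul j (atLeast 1) (mulAll fewerThanP N δ₀) N
      ≡⟨ mul-cong j (atLeast 1) (mulAll-extract fewerThanP N i δ₀ j≤N) N ⟩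
    mul j (atLeast 1) (mul j (below p) R) N
      ≡⟨ mul-atLeast1-below i p R N ⟩
    mul j (multBelow p) R N + p * mul j (atLeast p) R N
      ≡⟨ cong₂ (λ a x → a + p * x) (mulAll-set fewerThanP i (multBelow p) N δ₀ j≤N N)
                                  (mulAll-set fewerThanP i (atLeast p) N δ₀ j≤N N) ⟨
    mulAll (countPart j) N δ₀ N + p * mulAll (excessPart j) N δ₀ N ∎
    where
    open ≡-Reasoning
    j = suc i
    R = mulAll (set fewerThanP j δ₀) N δ₀

  weight-fewerThanP-≡1 : ∀ n x → AtMostPMinus1Times p x → weight fewerThanP n x ≡ 1
  weight-fewerThanP-≡1 n x mult<p =
    weight-≡1 fewerThanP n x λ v _ _ → below-≡1 p (mult v x) (mult-v<p v)
    where
    mult-v<p : ∀ v → mult v x < p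
    mult-v<p v with mult v x ≟ 0
    ... | yes mult≡0 = subst (_< p) (sym mult≡0) (s≤s z≤n)
    ... | no  mult≢0 = lookup mult<p (mult≢0⇒∈ v x mult≢0)

  weight-fewerThanP-≢0 : ∀ n x → All (1 ≤_) x → All (_≤ n) x →
    weight fewerThanP n x ≢ 0 → AtMostPMinus1Times p x
  weight-fewerThanP-≢0 n x x>0 x≤n w≢0 = tabulate λ {y} y∈x →
    below-≢0 p (mult y x) (weight-≢0 fewerThanP n x w≢0 y (lookup x>0 y∈x) (lookup x≤n y∈x))

  weight-countPart : ∀ K j x → 1 ≤ j → j ≤ K →
    weight (countPart j) K x ≡ mult j x * weight fewerThanP K x
  weight-countPart zero    j x 1≤j j≤0 = contradiction (≤-trans 1≤j j≤0) (λ ())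
  weight-countPart (suc K) j x 1≤j j≤1+K with j ≟ suc K
  ... | yes refl = trans (cong₂ _*_ (cong-app (set-≡ fewerThanP j (multBelow p)) (mult j x)) rest)
                         (*-assoc (mult j x) _ _)
    where
    rest : weight (countPart j) K x ≡ weight fewerThanP K x
    rest = weight-congˡ K x λ v _ v≤K →
      cong-app (set-≢ fewerThanP j (multBelow p) v (<⇒≢ (s≤s v≤K)))
  ... | no j≢1+K = trans
    (cong₂ _*_ (cong-app (set-≢ fewerThanP j (multBelow p) (suc K) (j≢1+K ∘ sym)) (mult (suc K) x))
               (weight-countPart K j x 1≤j (≤-pred (≤∧≢⇒< j≤1+K j≢1+K))))
    (x*[y*z]≡y*[x*z] (below p (mult (suc K) x)) (mult j x) (weight fewerThanP K x))
    where
    x*[y*z]≡y*[x*z] : ∀ x y z → x * (y * z) ≡ y * (x * z)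
    x*[y*z]≡y*[x*z] = solve-∀

  weight-onlyPart-≡1 : ∀ n x d → p ∣ₙ d → d ∈ x → All (λ y → p ∣ₙ y → y ≡ d) x →
    weight (onlyPart d) n x ≡ 1
  weight-onlyPart-≡1 n x d p∣d d∈x only-d = weight-≡1 (onlyPart d) n x λ v _ _ → factor v
    where
    factor : ∀ v → onlyPart d v (mult v x) ≡ 1
    factor v with v ≟ d
    ... | yes refl = trans (cong-app (onlyPart-≡ v) (mult v x))
                           (atLeast-≡1 1 (mult v x) (n≢0⇒n>0 (∈⇒mult≢0 v x d∈x)))
    ... | no v≢d with p ∣? v
    ...   | yes p∣v = trans (cong-app (trans (onlyPart-≢ d v v≢d) (noMultiplesOfP-∣ v p∣v)) _)
                            (cong δ₀ (∉⇒mult≡0 v x (λ v∈x → v≢d (lookup only-d v∈x p∣v))))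
    ...   | no  p∤v = cong-app (trans (onlyPart-≢ d v v≢d) (noMultiplesOfP-∤ v p∤v)) (mult v x)

  weight-onlyPart-≢0 : ∀ n x j → All (1 ≤_) x → All (_≤ n) x → 1 ≤ j → j ≤ n →
    weight (onlyPart j) n x ≢ 0 → j ∈ x × All (λ y → p ∣ₙ y → y ≡ j) x
  weight-onlyPart-≢0 n x j x>0 x≤n 1≤j j≤n w≢0 = j∈x , tabulate only-j
    where
    factor≢0 : ∀ v → 1 ≤ v → v ≤ n → onlyPart j v (mult v x) ≢ 0
    factor≢0 = weight-≢0 (onlyPart j) n x w≢0
    j∈x : j ∈ x
    j∈x = mult≢0⇒∈ j x λ mult≡0 →
      factor≢0 j 1≤j j≤n (trans (cong-app (onlyPart-≡ j) (mult j x)) (cong (atLeast 1) mult≡0))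
    only-j : ∀ {y} → y ∈ x → p ∣ₙ y → y ≡ j
    only-j {y} y∈x p∣y = decidable-stable (y ≟ j) λ y≢j →
      ∈⇒mult≢0 y x y∈x (δ₀-≢0 (mult y x)
        (subst (_≢ 0) (cong-app (trans (onlyPart-≢ j y y≢j) (noMultiplesOfP-∣ y p∣y)) (mult y x))
               (factor≢0 y (lookup x>0 y∈x) (lookup x≤n y∈x))))

  numPartsDiv-∷ : ∀ a x → numPartsDiv p (a ∷ x) ≡ when (p ∣? a) 1 + numPartsDiv p x
  numPartsDiv-∷ a x with p ∣? a
  ... | yes p∣a = cong length (filter-accept (p ∣?_) p∣a)
  ... | no  p∤a = cong length (filter-reject (p ∣?_) p∤a)

  numPartsDiv-Σ : ∀ n x → All (1 ≤_) x → All (_≤ n) x →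
    numPartsDiv p x ≡ Σ< n (λ i → when (p ∣? suc i) (mult (suc i) x))
  numPartsDiv-Σ n []      _           _           = sym (Σ<-zero n _ (λ i _ → when-0 (p ∣? suc i)))
  numPartsDiv-Σ n (a ∷ x) (a>0 ∷ x>0) (a≤n ∷ x≤n) = begin
    numPartsDiv p (a ∷ x)
      ≡⟨ numPartsDiv-∷ a x ⟩
    when (p ∣? a) 1 + numPartsDiv p x
      ≡⟨ cong₂ _+_ (sym (head-Σ a a>0 a≤n)) (numPartsDiv-Σ n x x>0 x≤n) ⟩
    Σ< n (head a) + Σ< n (count x)
      ≡⟨ Σ<-+ n (head a) (count x) ⟨
    Σ< n (λ i → head a i + count x i)
      ≡⟨ Σ<-cong′ n count-∷ ⟨
    Σ< n (count (a ∷ x)) ∎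
    where
    open ≡-Reasoning
    count : List ℕ → ℕ → ℕ
    count y i = when (p ∣? suc i) (mult (suc i) y)
    head : ℕ → ℕ → ℕ
    head a i = when (p ∣? suc i) (when (a ≟ suc i) 1)
    count-∷ : ∀ i → count (a ∷ x) i ≡ head a i + count x i
    count-∷ i = trans (cong (when (p ∣? suc i)) (mult-∷ a (suc i) x)) (when-+ (p ∣? suc i) _ _)
    head-Σ : ∀ a → 1 ≤ a → a ≤ n → Σ< n (head a) ≡ when (p ∣? a) 1
    head-Σ (suc k) _ k<n = trans (Σ<-single n k (head (suc k)) k<n others)
                                 (cong (when (p ∣? suc k)) (when-yes (suc k ≟ suc k) refl))
      where
      others : ∀ i → i < n → i ≢ k → head (suc k) i ≡ 0
      others i _ i≢k = trans (cong (when (p ∣? suc i)) (when-no (suc k ≟ suc i) 1+k≢1+i)) (when-0 (p ∣? suc i))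
        where
        1+k≢1+i = i≢k ∘ sym ∘ suc-injective

  divisibleWeight : (ℕ → Weights) → ℕ → List ℕ → ℕ
  divisibleWeight c n x = Σ< n (λ i → when (p ∣? suc i) (weight (c (suc i)) n x))

  divisibleTotal : (ℕ → Weights) → ℕ → ℕ
  divisibleTotal c n = Σ< n (λ i → when (p ∣? suc i) (mulAll (c (suc i)) n δ₀ n))

  countPart-indicator : ∀ n La → Enumerates n La (AtMostPMinus1Times p) →
    ∀ x → BoundedPartition n n x → when (x ∈? La) (numPartsDiv p x) ≡ divisibleWeight countPart n x
  countPart-indicator n La La⇔ x (x⊢n@(x>0 , _) , x≤n) = sym (begin
    Σ< n (λ i → when (p ∣? suc i) (weight (countPart (suc i)) n x))
      ≡⟨ Σ<-cong n factor-w ⟩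
    Σ< n (λ i → w * when (p ∣? suc i) (mult (suc i) x))
      ≡⟨ Σ<-* n w _ ⟩
    w * Σ< n (λ i → when (p ∣? suc i) (mult (suc i) x))
      ≡⟨ cong (w *_) (numPartsDiv-Σ n x x>0 x≤n) ⟨
    w * numPartsDiv p x
      ≡⟨ indicator (x ∈? La) ⟩
    when (x ∈? La) (numPartsDiv p x) ∎)
    where
    open ≡-Reasoning
    w = weight fewerThanP n x
    factor-w : ∀ i → i < n →
      when (p ∣? suc i) (weight (countPart (suc i)) n x) ≡ w * when (p ∣? suc i) (mult (suc i) x)
    factor-w i i<n = trans (cong (when (p ∣? suc i)) w-last) (when-* (p ∣? suc i) w _)
      where
      w-last = trans (weight-countPart n (suc i) x (s≤s z≤n) i<n) (*-comm (mult (suc i) x) w)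
    indicator : (x∈? : Dec (x ∈ La)) → w * numPartsDiv p x ≡ when x∈? (numPartsDiv p x)
    indicator (yes x∈La) = trans (cong (_* numPartsDiv p x) w≡1) (*-identityˡ _)
      where
      w≡1 = weight-fewerThanP-≡1 n x (proj₂ (Equivalence.to (La⇔ x) x∈La))
    indicator (no x∉La) = cong (_* numPartsDiv p x) (decidable-stable (w ≟ 0) λ w≢0 →
      x∉La (Equivalence.from (La⇔ x) (x⊢n , weight-fewerThanP-≢0 n x x>0 x≤n w≢0)))

  onlyPart-term≢0 : ∀ n x i → BoundedPartition n n x → suc i ≤ n →
    when (p ∣? suc i) (weight (onlyPart (suc i)) n x) ≢ 0 →
    p ∣ₙ suc i × suc i ∈ x × All (λ y → p ∣ₙ y → y ≡ suc i) x
  onlyPart-term≢0 n x i ((x>0 , _) , x≤n) i<n term≢0 with p ∣? suc i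
  ... | yes p∣j = p∣j , weight-onlyPart-≢0 n x (suc i) x>0 x≤n (s≤s z≤n) i<n term≢0
  ... | no _    = contradiction refl term≢0

  onlyPart-indicator : ∀ n Lo → Enumerates n Lo (OneDivisibleValue p) →
    ∀ x → BoundedPartition n n x → when (x ∈? Lo) 1 ≡ divisibleWeight onlyPart n x
  onlyPart-indicator n Lo Lo⇔ x x⊢n@((x>0 , _) , x≤n) with x ∈? Lo
  ... | yes x∈Lo = let (_ , d , p∣d , d∈x , only-d) = Equivalence.to (Lo⇔ x) x∈Lo
                   in sym (single d (lookup x>0 d∈x) (lookup x≤n d∈x) p∣d d∈x only-d)
    where
    term : ℕ → ℕ
    term i = when (p ∣? suc i) (weight (onlyPart (suc i)) n x)
    single : ∀ d → 1 ≤ d → d ≤ n → p ∣ₙ d → d ∈ x →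
      All (λ y → p ∣ₙ y → y ≡ d) x → Σ< n term ≡ 1
    single (suc k) _ k<n p∣d d∈x only-d = trans (Σ<-single n k term k<n others)
      (trans (when-yes (p ∣? suc k) p∣d) (weight-onlyPart-≡1 n x (suc k) p∣d d∈x only-d))
      where
      others : ∀ i → i < n → i ≢ k → term i ≡ 0
      others i i<n i≢k = decidable-stable (term i ≟ 0) λ term≢0 →
        let (_ , _ , only-j) = onlyPart-term≢0 n x i x⊢n i<n term≢0
        in i≢k (suc-injective (sym (lookup only-j d∈x p∣d)))
  ... | no x∉Lo = sym (Σ<-zero n _ λ i i<n → decidable-stable (_ ≟ 0) λ term≢0 →
    let (p∣j , j∈x , only-j) = onlyPart-term≢0 n x i x⊢n i<n term≢0
    in x∉Lo (Equivalence.from (Lo⇔ x) (proj₁ x⊢n , suc i , p∣j , j∈x , only-j)))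

  sum-by-indicator : ∀ n (c : ℕ → Weights) (g : List ℕ → ℕ) L → Unique L →
    (∀ {x} → x ∈ L → IsPartition n x) →
    (∀ x → BoundedPartition n n x → when (x ∈? L) (g x) ≡ divisibleWeight c n x) →
    sum (map g L) ≡ divisibleTotal c n
  sum-by-indicator n c g L L! L⊢n indicator = begin
    sum (map g L)
      ≡⟨ sum-⊆-unique L U g L! (partitions-unique n n) L⊆U ⟩
    sum (map (λ x → when (x ∈? L) (g x)) U)
      ≡⟨ cong sum (map-cong-local (tabulate λ {x} x∈U → indicator x (partitions-sound n n x x∈U))) ⟩
    sum (map (λ x → Σ< n (λ i → term i x)) U)
      ≡⟨ sum-map-Σ< U n term ⟩
    Σ< n (λ i → sum (map (term i) U))
      ≡⟨ Σ<-cong′ n (λ i → trans (sum-map-when (p ∣? suc i) (weight (c (suc i)) n) U)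
                                 (cong (when (p ∣? suc i)) (sum-weight-partitions (c (suc i)) n n))) ⟩
    divisibleTotal c n ∎
    where
    open ≡-Reasoning
    U = partitions n n
    L⊆U : ∀ {x} → x ∈ L → x ∈ U
    L⊆U x∈L = partitions-complete n n _ (IsPartition⇒BoundedPartition n _ (L⊢n x∈L))
    term : ℕ → List ℕ → ℕ
    term i x = when (p ∣? suc i) (weight (c (suc i)) n x)

  divisibleTotal-onlyPart : ∀ n →
    divisibleTotal onlyPart n ≡ divisibleTotal countPart n + p * divisibleTotal excessPart n
  divisibleTotal-onlyPart n =
    trans (Σ<-cong n per-part) (trans (Σ<-+ n _ _) (cong (divisibleTotal countPart n +_) (Σ<-* n p _)))
    where
    total : (ℕ → Weights) → ℕ → ℕ
    total c i = when (p ∣? suc i) (mulAll (c (suc i)) n δ₀ n)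
    per-part : ∀ i → i < n → total onlyPart i ≡ total countPart i + p * total excessPart i
    per-part i i<n with p ∣? suc i
    ... | yes p∣j = onlyPart≡countPart+p*excessPart i n i<n p∣j
    ... | no _    = sym (*-zeroʳ p)

-- Imported only here: in scope earlier, the prefix +_ would make sections such as (a +_) ambiguous.
open import Data.Integer using (+_; _-_; _⊖_)
open import Data.Integer.Divisibility using (_∣_)
import Data.Integer as ℤ using (∣_∣)
import Data.Integer.Properties as ℤ

+∣+a-+[a+p*X] : ∀ p a X → (+ p) ∣ (+ a - + (a + p * X))
+∣+a-+[a+p*X] p a X = subst (p ∣ₙ_) (sym ∣a-[a+p*X]∣≡p*X) (m∣m*n X)
  where
  ∣a-[a+p*X]∣≡p*X : ℤ.∣ + a - + (a + p * X) ∣ ≡ p * X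
  ∣a-[a+p*X]∣≡p*X = begin
    ℤ.∣ + a - + (a + p * X) ∣  ≡⟨ cong ℤ.∣_∣ (ℤ.m-n≡m⊖n a (a + p * X)) ⟩
    ℤ.∣ a ⊖ (a + p * X) ∣      ≡⟨ ℤ.∣m⊖n∣≡∣n⊖m∣ a (a + p * X) ⟩
    ℤ.∣ (a + p * X) ⊖ a ∣      ≡⟨ cong ℤ.∣_∣ (ℤ.⊖-≥ (m≤m+n a (p * X))) ⟩
    a + p * X ∸ a              ≡⟨ m+n∸m≡n a (p * X) ⟩
    p * X                      ∎
    where open ≡-Reasoning

theorem3 : (p : ℕ) → .{{_ : NonZero p}} → (n : ℕ)
    → (La : List (List ℕ)) → Unique La
    → (∀ λs → (λs ∈ La) ⇔ (IsPartition n λs × AtMostPMinus1Times p λs))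
    → (Lo : List (List ℕ)) → Unique Lo
    → (∀ λs → (λs ∈ Lo) ⇔ (IsPartition n λs × OneDivisibleValue p λs))
    → (+ p) ∣ (+ sum (map (numPartsDiv p) La) - + length Lo)
theorem3 (suc p′) n La La! La⇔ Lo Lo! Lo⇔ =
  subst₂ (λ a o → (+ p) ∣ (+ a - + o)) (sym a≡) (sym o≡)
         (+∣+a-+[a+p*X] p (divisibleTotal countPart n) (divisibleTotal excessPart n))
  where
  open Glaisher p′ using (p)
  open Counting p′
  a≡ : sum (map (numPartsDiv p) La) ≡ divisibleTotal countPart n
  a≡ = sum-by-indicator n countPart (numPartsDiv p) La La! (proj₁ ∘ Equivalence.to (La⇔ _))
                        (countPart-indicator n La La⇔)
  o≡ : length Lo ≡ divisibleTotal countPart n + p * divisibleTotal excessPart n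
  o≡ = begin
    length Lo
      ≡⟨ length≡sum-map-1 Lo ⟩
    sum (map (λ _ → 1) Lo)
      ≡⟨ sum-by-indicator n onlyPart (λ _ → 1) Lo Lo! (proj₁ ∘ Equivalence.to (Lo⇔ _))
                          (onlyPart-indicator n Lo Lo⇔) ⟩
    divisibleTotal onlyPart n
      ≡⟨ divisibleTotal-onlyPart n ⟩
    divisibleTotal countPart n + p * divisibleTotal excessPart n ∎
    where open ≡-Reasoning
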